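{- Let $k,m<\omega$ and let $G,H$ be finite digraphs. Then: (1) if $\forall$ has a winning strategy in the strong Seurat game $\hat{\mathbf{G}}^k(G,H)$, then he has a winning strategy in $\mathbf{MSO}^k_2(G,H)$; (2) if $\forall$ has a winning strategy in $\mathbf{MSO}^k_m(G,H)$ and $k+m\geq 2$, then he has a winning strategy in the Seurat game $\mathbf{G}^{k+m}(G,H)$.
   Context: Digraphs: finite vertex set with edge relation (loops allowed, no multiple edges). Seurat game $\mathbf{G}^k(G,H)$: two players $\forall,\exists$, a set $\mathbf{Col}$ of $k$ colours. A position is a pair of functions $g:\mathbf{Col}\to\wp(G)$, $h:\mathbf{Col}\to\wp(H)$, initially all empty. In each of $\omega$ rounds $\forall$ chooses a colour $c$, one of the graphs and a subset of its vertices; $\exists$ then chooses a subset of the other graph; $c$ is then assigned these two sets (erasing its previous use). The palette of a vertex is the set of colours whose set contains it; $P^G$ is the set of vertices of $G$ with palette exactly $P$. $\forall$ wins in round $n$ if at its beginning (C1) some palette $P$ has $P^G$ empty and $P^H$ nonempty or vice versa, or (C2) there are palettes $P_1,P_2$ with an edge from $P_1^G$ to $P_2^G$ but none from $P_1^H$ to $P_2^H$, or vice versa. The strong game $\hat{\mathbf{G}}^k(G,H)$ additionally lets $\forall$ win if (C3) there are palettes $P_1,P_2$ such that every vertex of $P_2^G$ is the target of an edge from $P_1^G$ but some vertex of $P_2^H$ is not the target of an edge from $P_1^H$, or vice versa; or (C4) there are palettes $P_1,P_2$ such that every vertex of $P_1^G$ is the source of an edge into $P_2^G$ but some vertex of $P_1^H$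 is not, or vice versa. A player has a winning strategy if $\forall$ can force a win in finitely many rounds (for $\forall$) or can prevent $\forall$ from ever winning (for $\exists$). The game $\mathbf{MSO}^k_m(G,H)$: played with $k$ colours and $m$ pairs of pebbles. In each of $\omega$ rounds $\forall$ either chooses a colour and colours (i.e. assigns that colour to, erasing its previous use in that graph) a set of vertices of $G$ or $H$, in which case $\exists$ assigns the same colour to a set of vertices of the other graph; or chooses a pebble pair and places one pebble of the pair on a vertex of $G$ or $H$, in which case $\exists$ places the other pebble of the pair on a vertex of the other graph. $\forall$ wins in round $n$ if at its beginning the relation pairing, for each placed pebble pair, the vertex of $G$ carrying one pebble with the vertex of $H$ carrying the other, is not a partial isomorphism with respect to the edge relation and the $k$ unary predicates given by the colours. -}

module Defs where

open import Data.Nat using (ℕ)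
open import Data.Fin using (Fin; _≟_)
open import Data.Bool using (Bool; true; false; if_then_else_)
open import Data.Maybe using (Maybe; just; nothing)
open import Data.Product using (Σ; _×_; _,_)
open import Data.Sum using (_⊎_)
open import Relation.Nullary using (¬_; does)
open import Relation.Binary.PropositionalEquality using (_≡_)

record Digraph : Set where
  field
    size : ℕ
    edge : Fin size → Fin size → Bool

open Digraph public

V : Digraph → Set
V G = Fin (size G)

E : (G : Digraph) → V G → V G → Set
E G u v = edge G u v ≡ true

VSet : Digraph → Set
VSet G = V G → Bool

Colouring : ℕ → Digraph → Set
Colouring k G = Fin k → VSet G

emptyCol : ∀ {k} (G : Digraph) → Colouring k G
emptyCol G _ _ = false

upd : ∀ {k} (G : Digraph) → Colouring k G → Fin k → VSet G → Colouring k G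
upd G g c X c' = if does (c' ≟ c) then X else g c'

Palette : ℕ → Set
Palette k = Fin k → Bool

HasPal : ∀ {k} (G : Digraph) → Colouring k G → Palette k → V G → Set
HasPal G g P v = ∀ c → g c v ≡ P c

-- One-directional versions of the winning conditions (G against H);
-- the "or vice versa" is obtained by swapping the arguments.

C1→ : ∀ {k} (G H : Digraph) → Colouring k G → Colouring k H → Set
C1→ {k} G H g h =
  Σ (Palette k) λ P → (¬ Σ (V G) λ v → HasPal G g P v) × (Σ (V H) λ w → HasPal H h P w)

C2→ : ∀ {k} (G H : Digraph) → Colouring k G → Colouring k H → Set
C2→ {k} G H g h =
  Σ (Palette k) λ P₁ → Σ (Palette k) λ P₂ →
    (Σ (V G) λ u → Σ (V G) λ v → HasPal G g P₁ u × HasPal G g P₂ v × E G u v)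
    × ¬ (Σ (V H) λ u → Σ (V H) λ v → HasPal H h P₁ u × HasPal H h P₂ v × E H u v)

C3→ : ∀ {k} (G H : Digraph) → Colouring k G → Colouring k H → Set
C3→ {k} G H g h =
  Σ (Palette k) λ P₁ → Σ (Palette k) λ P₂ →
    ((v : V G) → HasPal G g P₂ v → Σ (V G) λ u → HasPal G g P₁ u × E G u v)
    × (Σ (V H) λ v → HasPal H h P₂ v × ¬ (Σ (V H) λ u → HasPal H h P₁ u × E H u v))

C4→ : ∀ {k} (G H : Digraph) → Colouring k G → Colouring k H → Set
C4→ {k} G H g h =
  Σ (Palette k) λ P₁ → Σ (Palette k) λ P₂ →
    ((u : V G) → HasPal G g P₁ u → Σ (V G) λ v → HasPal G g P₂ v × E G u v)
    × (Σ (V H) λ u → HasPal H h P₁ u × ¬ (Σ (V H) λ v → HasPal H h P₂ v × E H u v))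

-- ∀ wins (immediately) in the Seurat game
SeuratLose : ∀ {k} (G H : Digraph) → Colouring k G → Colouring k H → Set
SeuratLose G H g h =
  C1→ G H g h ⊎ C1→ H G h g ⊎ C2→ G H g h ⊎ C2→ H G h g

StrongSeuratLose : ∀ {k} (G H : Digraph) → Colouring k G → Colouring k H → Set
StrongSeuratLose G H g h =
  SeuratLose G H g h ⊎ C3→ G H g h ⊎ C3→ H G h g ⊎ C4→ G H g h ⊎ C4→ H G h g

-- Colour games: ∀ can force a win in finitely many rounds from the
-- position (g , h), given the immediate winning condition Win.

data ColourGameWin {k : ℕ} (G H : Digraph)
       (Win : Colouring k G → Colouring k H → Set)
       : Colouring k G → Colouring k H → Set where
  won   : ∀ {g h} → Win g h → ColourGameWin G H Win g h
  moveG : ∀ {g h} (c : Fin k) (X : VSet G) →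
          ((Y : VSet H) → ColourGameWin G H Win (upd G g c X) (upd H h c Y)) →
          ColourGameWin G H Win g h
  moveH : ∀ {g h} (c : Fin k) (Y : VSet H) →
          ((X : VSet G) → ColourGameWin G H Win (upd G g c X) (upd H h c Y)) →
          ColourGameWin G H Win g h

SeuratWin : ℕ → Digraph → Digraph → Set
SeuratWin k G H = ColourGameWin {k} G H (SeuratLose G H) (emptyCol G) (emptyCol H)

StrongSeuratWin : ℕ → Digraph → Digraph → Set
StrongSeuratWin k G H = ColourGameWin {k} G H (StrongSeuratLose G H) (emptyCol G) (emptyCol H)

Pebbles : ℕ → Digraph → Digraph → Set
Pebbles m G H = Fin m → Maybe (V G × V H)

placePeb : ∀ {m} (G H : Digraph) → Pebbles m G H → Fin m → V G → V H → Pebbles m G H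
placePeb G H p i a b j = if does (j ≟ i) then just (a , b) else p j

PartialIso : ∀ {k m} (G H : Digraph) → Colouring k G → Colouring k H → Pebbles m G H → Set
PartialIso {k} {m} G H g h p =
  (i j : Fin m) (a a' : V G) (b b' : V H) →
    p i ≡ just (a , b) → p j ≡ just (a' , b') →
    ((a ≡ a' → b ≡ b') × (b ≡ b' → a ≡ a'))
    × ((E G a a' → E H b b') × (E H b b' → E G a a'))
    × ((c : Fin k) → g c a ≡ h c b)

data MSOGameWin {k m : ℕ} (G H : Digraph)
       : Colouring k G → Colouring k H → Pebbles m G H → Set where
  won   : ∀ {g h p} → ¬ PartialIso G H g h p → MSOGameWin G H g h p
  colG  : ∀ {g h p} (c : Fin k) (X : VSet G) →
          ((Y : VSet H) → MSOGameWin G H (upd G g c X) (upd H h c Y) p) →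
          MSOGameWin G H g h p
  colH  : ∀ {g h p} (c : Fin k) (Y : VSet H) →
          ((X : VSet G) → MSOGameWin G H (upd G g c X) (upd H h c Y) p) →
          MSOGameWin G H g h p
  pebG  : ∀ {g h p} (i : Fin m) (a : V G) →
          ((b : V H) → MSOGameWin G H g h (placePeb G H p i a b)) →
          MSOGameWin G H g h p
  pebH  : ∀ {g h p} (i : Fin m) (b : V H) →
          ((a : V G) → MSOGameWin G H g h (placePeb G H p i a b)) →
          MSOGameWin G H g h p

MSOWin : ℕ → ℕ → Digraph → Digraph → Set
MSOWin k m G H = MSOGameWin {k} {m} G H (emptyCol G) (emptyCol H) (λ _ → nothing)

-- (1) ∀ copies the colour moves of his strong Seurat strategy into the
-- MSO game.  When a condition C1–C4 is reached, one or two pebbles expose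
-- a failure of partial isomorphism: for C3, say, he pebbles a vertex of
-- palette P₂ without a P₁-predecessor; ∃ must answer with a vertex of
-- palette P₂, which has a P₁-predecessor, and the second pebble goes there.
--
-- (2) Of the k + m Seurat colours, k copy the MSO colours and m record the
-- pebbles as singleton colours.  A pebble move becomes colouring a
-- singleton; ∃ must answer with a singleton, for otherwise a spare colour
-- (here k + m ≥ 2 is needed) separates two vertices of her answer and one
-- of their palettes is unrealised on the other side.  As long as all
-- answers are singletons, a failure of partial isomorphism between
-- pebbled vertices is visible as a condition C1 or C2 on their palettes.

module Submission where

open import Defs
open import Data.Nat using (ℕ; zero; suc; _+_; _≤_; s≤s)
open import Data.Product using (_×_; _,_; ∃; ∃₂; proj₁; proj₂; swap)
open import Data.Fin using (Fin; zero; suc; _↑ˡ_; _↑ʳ_; splitAt; _≟_; punchIn)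
open import Data.Fin.Properties
  using (any?; all?; ∀-cons; splitAt-↑ˡ; splitAt-↑ʳ; ↑ˡ-injective; ↑ʳ-injective; punchInᵢ≢i)
open import Data.Bool using (true)
import Data.Bool.Properties as Bool
open import Data.Maybe as Maybe using (Maybe; just; nothing)
open import Data.Sum using (_⊎_; inj₁; inj₂; map₁; map₂; [_,_]′)
import Data.Sum.Effectful.Right as SumRight
open import Data.Empty using (⊥-elim)
open import Effect.Applicative using (RawApplicative)
open import Function using (_∘_; id; const)
open import Level using (0ℓ)
open import Relation.Nullary using (¬_; Dec; yes; no; does)
open import Relation.Nullary.Decidable using (_×-dec_; ¬?; dec-true; dec-false; decidable-stable; toSum)
open import Relation.Binary.PropositionalEquality
  using (_≡_; _≢_; refl; sym; trans; cong; cong-app; subst; subst₂)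

∀⊎⟶⊎∀ : ∀ {n} {P : Fin n → Set} {L : Set} → (∀ i → P i ⊎ L) → (∀ i → P i) ⊎ L
∀⊎⟶⊎∀ {zero}      _ = inj₁ λ ()
∀⊎⟶⊎∀ {suc n} {P} {L} f = ∀-cons {P = P} <$> f zero <*> ∀⊎⟶⊎∀ (f ∘ suc)
  where open RawApplicative (SumRight.applicative 0ℓ L)

implication-or-counterexample : ∀ {A B L : Set} → Dec A → Dec B → (A → ¬ B → L) → (A → B) ⊎ L
implication-or-counterexample _       (yes b) _ = inj₁ (const b)
implication-or-counterexample (yes a) (no ¬b) f = inj₂ (f a ¬b)
implication-or-counterexample (no ¬a) (no _)  _ = inj₁ (⊥-elim ∘ ¬a)

E? : (D : Digraph) (u v : V D) → Dec (E D u v)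
E? D u v = edge D u v Bool.≟ true

HasPal? : ∀ {k} (D : Digraph) (g : Colouring k D) (P : Palette k) (v : V D) → Dec (HasPal D g P v)
HasPal? D g P v = all? λ c → g c v Bool.≟ P c

another-colour : ∀ {n} → 2 ≤ n → (d : Fin n) → ∃ λ c → c ≢ d
another-colour (s≤s (s≤s _)) d = punchIn d zero , punchInᵢ≢i d zero

module _ {n : ℕ} (D : Digraph) (g : Colouring n D) where

  upd-same : ∀ c X → upd D g c X c ≡ X
  upd-same c X rewrite dec-true (c ≟ c) refl = refl

  upd-other : ∀ {c c'} X → c' ≢ c → upd D g c X c' ≡ g c'
  upd-other {c} {c'} X c'≢c rewrite dec-false (c' ≟ c) c'≢c = refl

upd-reindex : ∀ {k n} (D : Digraph) {g : Colouring k D} {g' : Colouring n D} {f : Fin k → Fin n} →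
  (∀ {c c'} → f c ≡ f c' → c ≡ c') → (∀ c → g' (f c) ≡ g c) →
  ∀ c X c' → upd D g' (f c) X (f c') ≡ upd D g c X c'
upd-reindex D {g' = g'} {f} f-inj agree c X c' with c' ≟ c
... | yes refl = upd-same D g' (f c) X
... | no c'≢c  = trans (upd-other D g' X (c'≢c ∘ f-inj)) (agree c')

palette : ∀ {n} (D : Digraph) → Colouring n D → V D → Palette n
palette D g v c = g c v

Singleton : (D : Digraph) → VSet D → V D → Set
Singleton D X a = X a ≡ true × (∀ v → X v ≡ true → v ≡ a)

Singleton-resp : ∀ (D : Digraph) {X Y : VSet D} {a} → X ≡ Y → Singleton D Y a → Singleton D X a
Singleton-resp D {a = a} X≡Y = subst (λ Z → Singleton D Z a) (sym X≡Y)

singleton : (D : Digraph) → V D → VSet D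
singleton D a v = does (v ≟ a)

singleton-Singleton : (D : Digraph) (a : V D) → Singleton D (singleton D a) a
singleton-Singleton D a = dec-true (a ≟ a) refl , member⇒≡
  where
  member⇒≡ : ∀ v → does (v ≟ a) ≡ true → v ≡ a
  member⇒≡ v _ with v ≟ a
  member⇒≡ v _  | yes v≡a = v≡a
  member⇒≡ v () | no _

empty-or-singleton-or-pair : (D : Digraph) (Y : VSet D) →
  (∀ w → Y w ≢ true) ⊎ (∃ λ b → Singleton D Y b) ⊎ (∃₂ λ b b' → Y b ≡ true × Y b' ≡ true × b' ≢ b)
empty-or-singleton-or-pair D Y with any? (λ w → Y w Bool.≟ true)
... | no none = inj₁ λ w Yw → none (w , Yw)
... | yes (b , Yb) with any? (λ w → (Y w Bool.≟ true) ×-dec ¬? (w ≟ b))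
...   | yes (b' , Yb' , b'≢b) = inj₂ (inj₂ (b , b' , Yb , Yb' , b'≢b))
...   | no no-other = inj₂ (inj₁ (b , Yb , λ w Yw →
          decidable-stable (w ≟ b) λ w≢b → no-other (w , Yw , w≢b)))

module _ {n : ℕ} (G H : Digraph) {g : Colouring n G} {h : Colouring n H} where

  palette-unrealised : (a : V G) → (∀ w → ¬ HasPal H h (palette G g a) w) → C1→ H G h g
  palette-unrealised a none = palette G g a , (λ (w , hw) → none w hw) , a , λ _ → refl

  colour-unmatched : ∀ {d a} → g d a ≡ true → (∀ w → h d w ≢ true) → C1→ H G h g
  colour-unmatched {d} {a} gda empty = palette-unrealised a λ w hw → empty w (trans (hw d) gda)

  marked-unique : ∀ {d b w} {P : Palette n} → Singleton H (h d) b → HasPal H h P w → P d ≡ true → w ≡ b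
  marked-unique (_ , unique) hw Pd = unique _ (trans (hw _) Pd)

  palette-mismatch : ∀ {d e a b} → g d a ≡ true → Singleton H (h d) b → g e a ≢ h e b → C1→ H G h g
  palette-mismatch {e = e} {a} gda hb ne = palette-unrealised a λ w hw →
    ne (trans (sym (hw e)) (cong (h e) (marked-unique hb hw gda)))

  edge-mismatch : ∀ {d d' a a' b b'} →
    g d a ≡ true → Singleton H (h d) b → g d' a' ≡ true → Singleton H (h d') b' →
    E G a a' → ¬ E H b b' → C2→ G H g h
  edge-mismatch {a = a} {a'} gda hb gda' hb' e ¬e =
    palette G g a , palette G g a' , (a , a' , (λ _ → refl) , (λ _ → refl) , e) ,
    λ (w , w' , hw , hw' , e') → ¬e (subst₂ (E H) (marked-unique hb hw gda) (marked-unique hb' hw' gda') e')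

-- Whichever colour c the vertex a gets, it differs from b or from b'.
separated-pair : ∀ {n} (G H : Digraph) {g : Colouring n G} {h : Colouring n H} {c d a b b'} →
  Singleton G (g d) a → h d b ≡ true → h d b' ≡ true → h c b ≡ true → h c b' ≢ true → C1→ G H g h
separated-pair G H {g} {h} {c} {a = a} ga hdb hdb' hcb ¬hcb' with g c a Bool.≟ true
... | yes gca = palette-mismatch H G {h} {g} {e = c} hdb' ga λ eq → ¬hcb' (trans eq gca)
... | no ¬gca = palette-mismatch H G {h} {g} {e = c} hdb ga λ eq → ¬gca (trans (sym eq) hcb)

SeuratLose-swap : ∀ {k} {G H : Digraph} {g : Colouring k G} {h : Colouring k H} →
  SeuratLose H G h g → SeuratLose G H g h
SeuratLose-swap (inj₁ c1)                = inj₂ (inj₁ c1)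
SeuratLose-swap (inj₂ (inj₁ c1))         = inj₁ c1
SeuratLose-swap (inj₂ (inj₂ (inj₁ c2)))  = inj₂ (inj₂ (inj₂ c2))
SeuratLose-swap (inj₂ (inj₂ (inj₂ c2)))  = inj₂ (inj₂ (inj₁ c2))

ColourGameWin-swap : ∀ {k} {G H : Digraph} {g : Colouring k G} {h : Colouring k H} →
  ColourGameWin H G (SeuratLose H G) h g → ColourGameWin G H (SeuratLose G H) g h
ColourGameWin-swap (won lose)    = won (SeuratLose-swap lose)
ColourGameWin-swap (moveG c Y f) = moveH c Y λ X → ColourGameWin-swap (f X)
ColourGameWin-swap (moveH c X f) = moveG c X λ Y → ColourGameWin-swap (f Y)

module _ {m : ℕ} {G H : Digraph} where

  Swapped : Pebbles m G H → Pebbles m H G → Set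
  Swapped p q = ∀ i → q i ≡ Maybe.map swap (p i)

  placePeb-Swapped : ∀ {p q} → Swapped p q → ∀ i a b →
    Swapped (placePeb G H p i a b) (placePeb H G q i b a)
  placePeb-Swapped s i a b j with j ≟ i
  ... | yes _ = refl
  ... | no  _ = s j

  Swapped-just : ∀ {p q i a b} → Swapped p q → q i ≡ just (b , a) → p i ≡ just (a , b)
  Swapped-just {p} {i = i} s e = unswap (p i) (trans (sym (s i)) e)
    where
    unswap : ∀ {a b} (x : Maybe (V G × V H)) → Maybe.map swap x ≡ just (b , a) → x ≡ just (a , b)
    unswap (just _) refl = refl

  PartialIso-swap : ∀ {k} {g : Colouring k G} {h : Colouring k H} {p q} → Swapped p q →
    PartialIso G H g h p → PartialIso H G h g q
  PartialIso-swap {p = p} {q} s iso i j b b' a a' e e'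
    with (ab , ba) , (EGH , EHG) , colours ← iso i j a a' b b' (Swapped-just {p} {q} s e) (Swapped-just {p} {q} s e')
    = (ba , ab) , (EHG , EGH) , λ c → sym (colours c)

  MSOGameWin-swap : ∀ {k} {g : Colouring k G} {h : Colouring k H} {p q} → Swapped p q →
    MSOGameWin H G h g q → MSOGameWin G H g h p
  MSOGameWin-swap {p = p} {q} s (won ¬iso) = won (¬iso ∘ PartialIso-swap {p = p} {q} s)
  MSOGameWin-swap s (colG c Y f)  = colH c Y λ X → MSOGameWin-swap s (f X)
  MSOGameWin-swap s (colH c X f)  = colG c X λ Y → MSOGameWin-swap s (f Y)
  MSOGameWin-swap s (pebG i b f)  = pebH i b λ a → MSOGameWin-swap (placePeb-Swapped s i a b) (f a)
  MSOGameWin-swap s (pebH i a f)  = pebG i a λ b → MSOGameWin-swap (placePeb-Swapped s i a b) (f b)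

ColourGameWin⇒MSOGameWin : ∀ {k m} {G H : Digraph} {W : Colouring k G → Colouring k H → Set}
  {p : Pebbles m G H} → (∀ {g h} → W g h → MSOGameWin G H g h p) →
  ∀ {g h} → ColourGameWin G H W g h → MSOGameWin G H g h p
ColourGameWin⇒MSOGameWin leaf (won w)       = leaf w
ColourGameWin⇒MSOGameWin leaf (moveG c X f) = colG c X λ Y → ColourGameWin⇒MSOGameWin leaf (f Y)
ColourGameWin⇒MSOGameWin leaf (moveH c Y f) = colH c Y λ X → ColourGameWin⇒MSOGameWin leaf (f X)

module _ {k : ℕ} {G H : Digraph} {g : Colouring k G} {h : Colouring k H} where

  private
    one : Fin 2
    one = suc zero

  iso-HasPal : ∀ {m} {p : Pebbles m G H} {a b P} → PartialIso G H g h p →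
    ∀ i → p i ≡ just (a , b) → HasPal G g P a → HasPal H h P b
  iso-HasPal iso i e ha c = trans (sym (proj₂ (proj₂ (iso i i _ _ _ _ e e)) c)) (ha c)

  iso-HasPal⁻¹ : ∀ {m} {p : Pebbles m G H} {a b P} → PartialIso G H g h p →
    ∀ i → p i ≡ just (a , b) → HasPal H h P b → HasPal G g P a
  iso-HasPal⁻¹ iso i e hb c = trans (proj₂ (proj₂ (iso i i _ _ _ _ e e)) c) (hb c)

  iso-edge : ∀ {m} {p : Pebbles m G H} {a a' b b'} → PartialIso G H g h p →
    ∀ i j → p i ≡ just (a , b) → p j ≡ just (a' , b') → E G a a' → E H b b'
  iso-edge iso i j e e' = proj₁ (proj₁ (proj₂ (iso i j _ _ _ _ e e')))

  C1⇒MSOWin : C1→ G H g h → MSOGameWin {k} {2} G H g h (λ _ → nothing)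
  C1⇒MSOWin (P , noG , w , hw) =
    pebH zero w λ a → won λ iso → noG (a , iso-HasPal⁻¹ iso zero refl hw)

  C2⇒MSOWin : C2→ G H g h → MSOGameWin {k} {2} G H g h (λ _ → nothing)
  C2⇒MSOWin (P₁ , P₂ , (u , v , hu , hv , e) , noH) =
    pebG zero u λ b → pebG one v λ b' → won λ iso →
      noH (b , b' , iso-HasPal iso zero refl hu ,
           iso-HasPal iso one refl hv , iso-edge iso zero one refl refl e)

  C3⇒MSOWin : C3→ G H g h → MSOGameWin {k} {2} G H g h (λ _ → nothing)
  C3⇒MSOWin (P₁ , P₂ , has-pred , w , hw , noH) = pebH zero w respond
    where
    respond : (a : V G) → MSOGameWin G H g h (placePeb G H (λ _ → nothing) zero a w)
    respond a with HasPal? G g P₂ a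
    ... | no ¬ha = won λ iso → ¬ha (iso-HasPal⁻¹ iso zero refl hw)
    ... | yes ha with u , hu , e ← has-pred a ha = pebG one u λ b → won λ iso →
          noH (b , iso-HasPal iso one refl hu , iso-edge iso one zero refl refl e)

  C4⇒MSOWin : C4→ G H g h → MSOGameWin {k} {2} G H g h (λ _ → nothing)
  C4⇒MSOWin (P₁ , P₂ , has-succ , w , hw , noH) = pebH zero w respond
    where
    respond : (a : V G) → MSOGameWin G H g h (placePeb G H (λ _ → nothing) zero a w)
    respond a with HasPal? G g P₁ a
    ... | no ¬ha = won λ iso → ¬ha (iso-HasPal⁻¹ iso zero refl hw)
    ... | yes ha with v , hv , e ← has-succ a ha = pebG one v λ b → won λ iso →
          noH (b , iso-HasPal iso one refl hv , iso-edge iso zero one refl refl e)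

StrongSeuratLose⇒MSOWin : ∀ {k} {G H : Digraph} {g : Colouring k G} {h : Colouring k H} →
  StrongSeuratLose G H g h → MSOGameWin {k} {2} G H g h (λ _ → nothing)
StrongSeuratLose⇒MSOWin (inj₁ (inj₁ c1))                = C1⇒MSOWin c1
StrongSeuratLose⇒MSOWin (inj₁ (inj₂ (inj₁ c1)))         = MSOGameWin-swap (λ _ → refl) (C1⇒MSOWin c1)
StrongSeuratLose⇒MSOWin (inj₁ (inj₂ (inj₂ (inj₁ c2))))  = C2⇒MSOWin c2
StrongSeuratLose⇒MSOWin (inj₁ (inj₂ (inj₂ (inj₂ c2))))  = MSOGameWin-swap (λ _ → refl) (C2⇒MSOWin c2)
StrongSeuratLose⇒MSOWin (inj₂ (inj₁ c3))                = C3⇒MSOWin c3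
StrongSeuratLose⇒MSOWin (inj₂ (inj₂ (inj₁ c3)))         = MSOGameWin-swap (λ _ → refl) (C3⇒MSOWin c3)
StrongSeuratLose⇒MSOWin (inj₂ (inj₂ (inj₂ (inj₁ c4))))  = C4⇒MSOWin c4
StrongSeuratLose⇒MSOWin (inj₂ (inj₂ (inj₂ (inj₂ c4))))  = MSOGameWin-swap (λ _ → refl) (C4⇒MSOWin c4)

module _ {n : ℕ} (2≤n : 2 ≤ n) where

  force-singletonᴳ : ∀ {G H : Digraph} {g : Colouring n G} {h : Colouring n H} d a →
    (∀ b Y → Singleton H Y b →
       ColourGameWin G H (SeuratLose G H) (upd G g d (singleton G a)) (upd H h d Y)) →
    ColourGameWin G H (SeuratLose G H) g h
  force-singletonᴳ {G} {H} {g} {h} d a continue = moveG d (singleton G a) respond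
    where
    g₁ = upd G g d (singleton G a)
    a-marked : Singleton G (g₁ d) a
    a-marked = Singleton-resp G (upd-same G g d _) (singleton-Singleton G a)

    respond : (Y : VSet H) → ColourGameWin G H (SeuratLose G H) g₁ (upd H h d Y)
    respond Y with empty-or-singleton-or-pair H Y
    ... | inj₁ empty = won (inj₂ (inj₁ (colour-unmatched G H (proj₁ a-marked) λ w →
            empty w ∘ trans (sym (cong-app (upd-same H h d Y) w)))))
    ... | inj₂ (inj₁ (b , Y≐b)) = continue b Y Y≐b
    ... | inj₂ (inj₂ (b , b' , Yb , Yb' , b'≢b)) =
          moveH c (singleton H b) λ X → won (inj₁ (separate X))
      where
      c = proj₁ (another-colour 2≤n d)
      d≢c : d ≢ c
      d≢c = proj₂ (another-colour 2≤n d) ∘ sym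
      h₁ = upd H h d Y
      b-single = singleton-Singleton H b

      h₂-d : ∀ Z → upd H h₁ c Z d ≡ Y
      h₂-d Z = trans (upd-other H h₁ Z d≢c) (upd-same H h d Y)

      h₂-c : ∀ Z → upd H h₁ c Z c ≡ Z
      h₂-c = upd-same H h₁ c

      separate : ∀ X → C1→ G H (upd G g₁ c X) (upd H h₁ c (singleton H b))
      separate X = separated-pair G H {c = c} {d}
        (Singleton-resp G (upd-other G g₁ X d≢c) a-marked)
        (trans (cong-app (h₂-d _) b) Yb)
        (trans (cong-app (h₂-d _) b') Yb')
        (trans (cong-app (h₂-c _) b) (proj₁ b-single))
        λ e → b'≢b (proj₂ b-single b' (trans (sym (cong-app (h₂-c _) b')) e))

  force-singletonᴴ : ∀ {G H : Digraph} {g : Colouring n G} {h : Colouring n H} d b →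
    (∀ a X → Singleton G X a →
       ColourGameWin G H (SeuratLose G H) (upd G g d X) (upd H h d (singleton H b))) →
    ColourGameWin G H (SeuratLose G H) g h
  force-singletonᴴ d b continue =
    ColourGameWin-swap (force-singletonᴳ d b λ a X X≐a → ColourGameWin-swap (continue a X X≐a))

module Simulation {k m : ℕ} {G H : Digraph} where

  colourᶜ : Fin k → Fin (k + m)
  colourᶜ c = c ↑ˡ m

  pebbleᶜ : Fin m → Fin (k + m)
  pebbleᶜ i = k ↑ʳ i

  pebbleᶜ≢colourᶜ : ∀ {i c} → pebbleᶜ i ≢ colourᶜ c
  pebbleᶜ≢colourᶜ {i} {c} e
    with () ← trans (sym (splitAt-↑ʳ k m i)) (trans (cong (splitAt k) e) (splitAt-↑ˡ k c m))

  record Simulates (g : Colouring k G) (h : Colouring k H) (p : Pebbles m G H)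
                   (g' : Colouring (k + m) G) (h' : Colouring (k + m) H) : Set where
    field
      colours-G : ∀ c → g' (colourᶜ c) ≡ g c
      colours-H : ∀ c → h' (colourᶜ c) ≡ h c
      pebbles   : ∀ i a b → p i ≡ just (a , b) →
                  Singleton G (g' (pebbleᶜ i)) a × Singleton H (h' (pebbleᶜ i)) b
  open Simulates

  simulates-initially : Simulates (emptyCol G) (emptyCol H) (λ _ → nothing) (emptyCol G) (emptyCol H)
  simulates-initially = record { colours-G = λ _ → refl ; colours-H = λ _ → refl ; pebbles = λ _ _ _ () }

  simulates-recolour : ∀ {g h p g' h'} → Simulates g h p g' h' → ∀ c X Y →
    Simulates (upd G g c X) (upd H h c Y) p (upd G g' (colourᶜ c) X) (upd H h' (colourᶜ c) Y)
  simulates-recolour {g} {h} {g' = g'} {h'} s c X Y = record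
    { colours-G = upd-reindex G {g = g} {g'} {colourᶜ} (↑ˡ-injective m _ _) (colours-G s) c X
    ; colours-H = upd-reindex H {g = h} {h'} {colourᶜ} (↑ˡ-injective m _ _) (colours-H s) c Y
    ; pebbles   = λ i a b e →
        Singleton-resp G (upd-other G g' X pebbleᶜ≢colourᶜ) (proj₁ (pebbles s i a b e)) ,
        Singleton-resp H (upd-other H h' Y pebbleᶜ≢colourᶜ) (proj₂ (pebbles s i a b e))
    }

  simulates-place : ∀ {g h p g' h'} → Simulates g h p g' h' → ∀ i {a b X Y} →
    Singleton G X a → Singleton H Y b →
    Simulates g h (placePeb G H p i a b) (upd G g' (pebbleᶜ i) X) (upd H h' (pebbleᶜ i) Y)
  simulates-place {p = p} {g'} {h'} s i {a₀} {b₀} {X} {Y} X≐a Y≐b = record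
    { colours-G = λ c → trans (upd-other G g' X (pebbleᶜ≢colourᶜ ∘ sym)) (colours-G s c)
    ; colours-H = λ c → trans (upd-other H h' Y (pebbleᶜ≢colourᶜ ∘ sym)) (colours-H s c)
    ; pebbles   = marks
    }
    where
    marks : ∀ j a b → placePeb G H p i a₀ b₀ j ≡ just (a , b) →
            Singleton G (upd G g' (pebbleᶜ i) X (pebbleᶜ j)) a × Singleton H (upd H h' (pebbleᶜ i) Y (pebbleᶜ j)) b
    marks j a b e with j ≟ i
    marks j a b refl | yes refl =
      Singleton-resp G (upd-same G g' _ X) X≐a , Singleton-resp H (upd-same H h' _ Y) Y≐b
    marks j a b e    | no j≢i =
      let j≢i' = j≢i ∘ ↑ʳ-injective k j i in
      Singleton-resp G (upd-other G g' X j≢i') (proj₁ (pebbles s j a b e)) ,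
      Singleton-resp H (upd-other H h' Y j≢i') (proj₂ (pebbles s j a b e))

  PairIso : Colouring k G → Colouring k H → V G → V G → V H → V H → Set
  PairIso g h a a' b b' =
    ((a ≡ a' → b ≡ b') × (b ≡ b' → a ≡ a'))
    × ((E G a a' → E H b b') × (E H b b' → E G a a'))
    × ((c : Fin k) → g c a ≡ h c b)

  module _ {g h p g' h'} (s : Simulates g h p g' h') where

    private
      L = SeuratLose G H g' h'
      open RawApplicative (SumRight.applicative 0ℓ L) using (_⊗_)

    palettes-or-lose : ∀ {i a b} → Singleton G (g' (pebbleᶜ i)) a → Singleton H (h' (pebbleᶜ i)) b →
      (∀ c → g c a ≡ h c b) ⊎ L
    palettes-or-lose {a = a} {b} ga hb = ∀⊎⟶⊎∀ λ c → map₂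
      (λ ne → inj₂ (inj₁ (palette-mismatch G H (proj₁ ga) hb λ eq →
        ne (trans (sym (cong-app (colours-G s c) a)) (trans eq (cong-app (colours-H s c) b))))))
      (toSum (g c a Bool.≟ h c b))

    pair-iso-or-lose : ∀ {i j a a' b b'} →
      Singleton G (g' (pebbleᶜ i)) a → Singleton H (h' (pebbleᶜ i)) b →
      Singleton G (g' (pebbleᶜ j)) a' → Singleton H (h' (pebbleᶜ j)) b' →
      PairIso g h a a' b b' ⊎ L
    pair-iso-or-lose {a = a} {a'} {b} {b'} ga hb ga' hb' =
      (injective ⊗ injective⁻¹) ⊗ ((edges ⊗ edges⁻¹) ⊗ palettes-or-lose ga hb)
      where
      injective = implication-or-counterexample (a ≟ a') (b ≟ b') λ { refl b≢b' →
        inj₂ (inj₁ (palette-mismatch G H (proj₁ ga) hb λ eq → b≢b' (proj₂ hb' b (trans (sym eq) (proj₁ ga'))))) }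
      injective⁻¹ = implication-or-counterexample (b ≟ b') (a ≟ a') λ { refl a≢a' →
        inj₁ (palette-mismatch H G (proj₁ hb) ga λ eq → a≢a' (proj₂ ga' a (trans (sym eq) (proj₁ hb')))) }
      edges = implication-or-counterexample (E? G a a') (E? H b b') λ e ¬e →
        inj₂ (inj₂ (inj₁ (edge-mismatch G H (proj₁ ga) hb (proj₁ ga') hb' e ¬e)))
      edges⁻¹ = implication-or-counterexample (E? H b b') (E? G a a') λ e ¬e →
        inj₂ (inj₂ (inj₂ (edge-mismatch H G (proj₁ hb) ga (proj₁ hb') ga' e ¬e)))

    pebbles-iso-or-lose : ∀ i j →
      (∀ a a' b b' → p i ≡ just (a , b) → p j ≡ just (a' , b') → PairIso g h a a' b b') ⊎ L
    pebbles-iso-or-lose i j with p i in eᵢ | p j in eⱼ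
    ... | nothing | _ = inj₁ λ _ _ _ _ ()
    ... | just _ | nothing = inj₁ λ _ _ _ _ _ ()
    ... | just (a , b) | just (a' , b') =
          let ga , hb = pebbles s i a b eᵢ ; ga' , hb' = pebbles s j a' b' eⱼ in
          map₁ (λ iso → λ { _ _ _ _ refl refl → iso }) (pair-iso-or-lose ga hb ga' hb')

    lose-unless-iso : ¬ PartialIso G H g h p → L
    lose-unless-iso ¬iso = [ ⊥-elim ∘ ¬iso , id ]′ (∀⊎⟶⊎∀ λ i → ∀⊎⟶⊎∀ (pebbles-iso-or-lose i))

  simulate : 2 ≤ k + m → ∀ {g h p g' h'} → MSOGameWin G H g h p → Simulates g h p g' h' →
    ColourGameWin G H (SeuratLose G H) g' h'
  simulate 2≤k+m (won ¬iso)   s = won (lose-unless-iso s ¬iso)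
  simulate 2≤k+m (colG c X f) s = moveG (colourᶜ c) X λ Y → simulate 2≤k+m (f Y) (simulates-recolour s c X Y)
  simulate 2≤k+m (colH c Y f) s = moveH (colourᶜ c) Y λ X → simulate 2≤k+m (f X) (simulates-recolour s c X Y)
  simulate 2≤k+m (pebG i a f) s = force-singletonᴳ 2≤k+m (pebbleᶜ i) a λ b Y Y≐b →
    simulate 2≤k+m (f b) (simulates-place s i (singleton-Singleton G a) Y≐b)
  simulate 2≤k+m (pebH i b f) s = force-singletonᴴ 2≤k+m (pebbleᶜ i) b λ a X X≐a →
    simulate 2≤k+m (f a) (simulates-place s i X≐a (singleton-Singleton H b))

proposition3p3 : (k m : ℕ) (G H : Digraph) →
    (StrongSeuratWin k G H → MSOWin k 2 G H)
    × (MSOWin k m G H → 2 ≤ k + m → SeuratWin (k + m) G H)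
proposition3p3 k m G H =
  ColourGameWin⇒MSOGameWin StrongSeuratLose⇒MSOWin ,
  λ win 2≤k+m → simulate 2≤k+m win simulates-initially
  where open Simulation
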